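{- Let $F$ be a forest (of rooted trees) with $n$ vertices, and let $\mathcal L$ be a set of representatives of the isomorphism classes of labelings of $F$. Then, for an indeterminate $\alpha$, \[\sum_{L\in\mathcal L}(1+\alpha)^{\mathrm{prop}\,L}=|\mathcal L|\prod_{v\in V(F)}\left(1+\frac{\alpha}{h(v)}\right),\] where $\mathrm{prop}\,L$ is the number of vertices of $F$ that are proper with respect to $L$.
   Context: All trees are rooted and forests are forests of rooted trees (possibly ordered forests, in which case automorphisms must preserve the order structure). A vertex $w$ is a descendant of $v$ if $v$ lies on the path from the root to $w$; a proper descendant if moreover $w\ne v$. A labeling of $F$ is a bijection $V(F)\to[n]$. A vertex is proper with respect to a labeling if its label is less than the labels of all its proper descendants. The hook length $h(v)$ is the number of descendants of $v$, including $v$. Two labelings of $F$ are isomorphic if some automorphism of $F$ takes one to the other. -}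

module Defs where

open import Data.Nat as ℕ using (ℕ; zero; suc)
open import Data.Fin as Fin using (Fin; toℕ)
open import Data.Fin.Properties using (any?; all?) renaming (_≟_ to _≟ᶠ_)
open import Data.Fin.Permutation using (Permutation′; _⟨$⟩ʳ_)
open import Data.Maybe as Maybe using (Maybe; just; nothing)
open import Data.Maybe.Properties using (≡-dec)
open import Data.List as List using (List; allFin; filter; length; foldr)
open import Data.Product using (Σ; ∃; _×_)
open import Data.Rational as ℚ using (ℚ; 1ℚ; 0ℚ; _+_; _*_)
open import Data.Integer using (+_)
open import Relation.Binary.PropositionalEquality using (_≡_)
open import Relation.Nullary using (Dec)
open import Relation.Nullary.Decidable using (_→-dec_)

-- A rooted forest on the vertex set Fin n, given by its parent map
-- (nothing = the vertex is a root), required to be acyclic.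
-- up k w = the k-th ancestor of w (up 0 w = just w).
up : {n : ℕ} → (Fin n → Maybe (Fin n)) → ℕ → Fin n → Maybe (Fin n)
up par zero w = just w
up par (suc k) w with up par k w
... | just u  = par u
... | nothing = nothing

record Forest (n : ℕ) : Set where
  field
    parent  : Fin n → Maybe (Fin n)
    acyclic : ∀ v → up parent n v ≡ nothing
open Forest public

-- w is a proper descendant of v: v is the k-th ancestor of w for some 1 ≤ k ≤ n
-- (by acyclicity every ancestor is reached in at most n-1 steps).
ProperDesc : {n : ℕ} → Forest n → Fin n → Fin n → Set
ProperDesc {n} F v w = Σ (Fin n) λ k → up (parent F) (suc (toℕ k)) w ≡ just v

properDesc? : {n : ℕ} (F : Forest n) (v w : Fin n) → Dec (ProperDesc F v w)
properDesc? F v w = any? λ k → ≡-dec _≟ᶠ_ (up (parent F) (suc (toℕ k)) w) (just v)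

hook : {n : ℕ} → Forest n → Fin n → ℕ
hook {n} F v = suc (length (filter (properDesc? F v) (allFin n)))

-- Labelings: bijections V(F) = Fin n → [n] (labels 0..n-1, order-isomorphic to [n])
Labeling : ℕ → Set
Labeling n = Permutation′ n

Proper : {n : ℕ} → Forest n → Labeling n → Fin n → Set
Proper F L v = ∀ w → ProperDesc F v w → (L ⟨$⟩ʳ v) Fin.< (L ⟨$⟩ʳ w)

proper? : {n : ℕ} (F : Forest n) (L : Labeling n) (v : Fin n) → Dec (Proper F L v)
proper? F L v = all? λ w → properDesc? F v w →-dec ((L ⟨$⟩ʳ v) Fin.<? (L ⟨$⟩ʳ w))

prop : {n : ℕ} → Forest n → Labeling n → ℕ
prop {n} F L = length (filter (proper? F L) (allFin n))

IsAutomorphism : {n : ℕ} → Forest n → Permutation′ n → Set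
IsAutomorphism F σ = ∀ v → parent F (σ ⟨$⟩ʳ v) ≡ Maybe.map (σ ⟨$⟩ʳ_) (parent F v)

IsoLab : {n : ℕ} → Forest n → Labeling n → Labeling n → Set
IsoLab F L L' = ∃ λ σ → IsAutomorphism F σ × (∀ v → L' ⟨$⟩ʳ (σ ⟨$⟩ʳ v) ≡ L ⟨$⟩ʳ v)

IsRepresentatives : {n : ℕ} → Forest n → List (Labeling n) → Set
IsRepresentatives F 𝓛 =
  (∀ L → Σ (Fin (length 𝓛)) λ i → IsoLab F L (List.lookup 𝓛 i)) ×
  (∀ i j → IsoLab F (List.lookup 𝓛 i) (List.lookup 𝓛 j) → i ≡ j)

_^ℚ_ : ℚ → ℕ → ℚ
x ^ℚ zero = 1ℚ
x ^ℚ suc k = x * (x ^ℚ k)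

sumℚ : {A : Set} → (A → ℚ) → List A → ℚ
sumℚ f = foldr (λ a s → f a + s) 0ℚ

prodℚ : {A : Set} → (A → ℚ) → List A → ℚ
prodℚ f = foldr (λ a s → f a * s) 1ℚ

ℕtoℚ : ℕ → ℚ
ℕtoℚ m = (+ m) ℚ./ 1

{-# OPTIONS --safe #-}
module Submission where

-- Sum over all n! labelings instead of over 𝓛.  Automorphisms act freely on labelings and preserve
-- prop, so every isomorphism class has the same size c, the full sum of (1 + α) ^ prop L is c times
-- the sum over 𝓛, and n! = c · |𝓛|.  Over all labelings write (1 + α) ^ prop L = Π_v (1 + α [v proper])
-- and peel off the factors leaves first.  For w in the subtree of y, exchanging the labels of y and w
-- is a bijection of labelings which does not affect properness outside the subtree and makes y proper
-- exactly when w carried the least label of the subtree; averaging over the h(y) choices of w turns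
-- the factor of y into 1 + α / h(y).

open import Defs
open import Data.Nat using (ℕ)
open import Data.Fin using (Fin)
open import Data.List using (List; length; allFin)
open import Data.Rational using (ℚ; 1ℚ; _+_; _*_; _/_)
open import Data.Integer using (+_)
open import Relation.Binary.PropositionalEquality using (_≡_)

open import Algebra.Bundles using (CommutativeSemigroup)
open import Algebra.Core using (Op₂)
open import Algebra.Structures using (IsCommutativeMonoid)
import Algebra.Properties.CommutativeSemigroup as CommutativeSemigroupProperties
open import Data.Empty using (⊥-elim)
open import Data.Fin as Fin using (toℕ; fromℕ<; punchIn)
import Data.Fin.Permutation.Components as PC
import Data.Fin.Properties as FinP
open import Data.Fin.Properties using (toℕ-fromℕ<; punchIn-injective) renaming (_≟_ to _≟ᶠ_)
open import Data.Fin.Permutation as Perm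
  using ( Permutation′; _⟨$⟩ʳ_; _⟨$⟩ˡ_; _≈_; _∘ₚ_; flip; transpose; inverseˡ; inverseʳ
        ; insert; remove; insert-punchIn; insert-remove)
open import Data.Integer as ℤ using ()
import Data.Integer.Properties as ℤP
open import Data.List as List using ([]; _∷_; filter; foldr; map; lookup; cartesianProductWith)
open import Data.List.Properties using (foldr-map; map-tabulate; tabulate-lookup; filter-some)
open import Data.List.Membership.Propositional using (_∈_)
open import Data.List.Membership.Propositional.Properties using (∈-allFin; ∈-filter⁺; ∈-filter⁻)
import Data.List.Membership.Setoid as SetoidMembership
import Data.List.Membership.Setoid.Properties as SetoidMembershipProp
import Data.List.Relation.Binary.Permutation.Propositional as PropositionalPerm
import Data.List.Relation.Binary.Permutation.Setoid as SetoidPerm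
import Data.List.Relation.Binary.Permutation.Setoid.Properties as SetoidPermProp
import Data.List.Relation.Binary.Subset.Setoid as SetoidSubset
import Data.List.Sort as Sort
open import Data.List.Relation.Unary.All as All using (All; []; _∷_)
open import Data.List.Relation.Unary.AllPairs as AllPairs using (AllPairs; []; _∷_)
open import Data.List.Relation.Unary.Any as Any using (Any; here; there)
open import Data.List.Relation.Unary.Linked.Properties using (Linked⇒AllPairs)
open import Data.List.Relation.Unary.Unique.Propositional using (Unique)
import Data.List.Relation.Unary.Unique.Propositional.Properties as UniqueProp
import Data.List.Relation.Unary.Unique.Setoid as SetoidUnique
import Data.List.Relation.Unary.Unique.Setoid.Properties as SetoidUniqueProp
open import Data.Maybe as Maybe using (Maybe; just; nothing; _>>=_)
import Data.Maybe.Properties as MaybeP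
import Data.Maybe.Relation.Unary.All as MaybeAll
open import Data.Nat as ℕ using (zero; suc; compare; less; equal; greater; z≤n; s≤s)
import Data.Nat.Properties as ℕP
open import Data.Nat.Coprimality as Coprime using (1-coprimeTo)
open import Data.Product using (∃; _×_; _,_; proj₁; proj₂)
open import Data.Rational using (0ℚ; mkℚ)
import Data.Rational.Properties as ℚP
open import Data.Rational.Solver using (module +-*-Solver)
open import Data.Sum using (_⊎_; inj₁; inj₂)
open import Function using (_∘_; id; case_of_)
open import Function.Bundles using (Injection)
open import Function.Properties.Inverse using (↔⇒↣)
open import Level using (Level; 0ℓ)
open import Relation.Binary.Bundles using (Setoid)
import Relation.Binary.Construct.On as On
open import Relation.Binary.Definitions using (DecidableEquality)
open import Relation.Binary.PropositionalEquality
  using (_≢_; refl; sym; trans; cong; cong₂; subst; subst₂; setoid; module ≡-Reasoning)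
open import Relation.Nullary using (¬_; Dec; yes; no)
open import Relation.Nullary.Decidable using (dec-true; dec-false; _⊎-dec_)

private variable
  a ℓ : Level

module Enumeration (S : Setoid a ℓ) where
  open Setoid S using () renaming (Carrier to A; _≈_ to _≈ₛ_; refl to ≈-refl; sym to ≈-sym)
  open SetoidMembership S using () renaming (_∈_ to _∈ₛ_)
  open SetoidUnique S using () renaming (Unique to Uniqueₛ)
  open SetoidPerm S using (_↭_; ↭-refl; ↭-sym; ↭-trans; ↭-prep; ↭-reflexive-≋)
  open SetoidSubset S using (_⊆_)
  open SetoidMembershipProp using (∈-∃++; ∈-resp-≈; ∈-map⁺; All[≉]⇒∉)
  open SetoidPermProp using (shift; Unique-resp-↭; ∈-resp-↭)

  IsEnumeration : List A → Set _
  IsEnumeration xs = Uniqueₛ xs × (∀ x → x ∈ₛ xs)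

  unique-⊆-⊇⇒↭ : ∀ {xs ys} → Uniqueₛ xs → Uniqueₛ ys → xs ⊆ ys → ys ⊆ xs → xs ↭ ys
  unique-⊆-⊇⇒↭ {[]}     {[]}    _ _ _ _ = ↭-refl
  unique-⊆-⊇⇒↭ {[]}     {_ ∷ _} _ _ _ ys⊆xs with ys⊆xs (here ≈-refl)
  ... | ()
  unique-⊆-⊇⇒↭ {x ∷ xs} {ys} (x∉xs ∷ xs!) ys! xs⊆ys ys⊆xs
    with ∈-∃++ S (xs⊆ys (here ≈-refl))
  ... | us , vs , w , x≈w , ys≋ =
    ↭-trans (↭-prep x (unique-⊆-⊇⇒↭ xs! zs! xs⊆zs zs⊆xs)) (↭-sym ys↭)
    where
    zs : List A
    zs = us List.++ vs
    ys↭ : ys ↭ x ∷ zs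
    ys↭ = ↭-trans (↭-reflexive-≋ ys≋) (shift S (≈-sym x≈w) us vs)
    x∷zs! : Uniqueₛ (x ∷ zs)
    x∷zs! = Unique-resp-↭ S ys↭ ys!
    x∉zs : All (λ z → ¬ x ≈ₛ z) zs
    x∉zs = AllPairs.head x∷zs!
    zs! : Uniqueₛ zs
    zs! = AllPairs.tail x∷zs!
    xs⊆zs : xs ⊆ zs
    xs⊆zs a∈xs with ∈-resp-↭ S ys↭ (xs⊆ys (there a∈xs))
    ... | here a≈x   = ⊥-elim (All[≉]⇒∉ S x∉xs (∈-resp-≈ S a≈x a∈xs))
    ... | there a∈zs = a∈zs
    zs⊆xs : zs ⊆ xs
    zs⊆xs a∈zs with ys⊆xs (∈-resp-↭ S (↭-sym ys↭) (there a∈zs))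
    ... | here a≈x   = ⊥-elim (All[≉]⇒∉ S x∉zs (∈-resp-≈ S a≈x a∈zs))
    ... | there a∈xs = a∈xs

  ↭-of-enumerations : ∀ {xs ys} → IsEnumeration xs → IsEnumeration ys → xs ↭ ys
  ↭-of-enumerations (xs! , xs-complete) (ys! , ys-complete) =
    unique-⊆-⊇⇒↭ xs! ys! (λ {x} _ → ys-complete x) (λ {x} _ → xs-complete x)

  map-enumeration : ∀ {φ ψ : A → A} {xs} → (∀ {x y} → x ≈ₛ y → φ x ≈ₛ φ y) →
    (∀ {x y} → φ x ≈ₛ φ y → x ≈ₛ y) → (∀ x → φ (ψ x) ≈ₛ x) →
    IsEnumeration xs → IsEnumeration (map φ xs)
  map-enumeration φ-cong φ-injective φψ≈id (xs! , xs-complete) =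
    SetoidUniqueProp.map⁺ S S φ-injective xs! ,
    λ x → ∈-resp-≈ S (φψ≈id x) (∈-map⁺ S S φ-cong (xs-complete _))

module BigOperator {C : Set} {_∙_ : Op₂ C} {ε : C} (isCM : IsCommutativeMonoid _≡_ _∙_ ε) where
  open IsCommutativeMonoid isCM using (identityˡ; isCommutativeSemigroup)

  private
    commutativeSemigroup : CommutativeSemigroup 0ℓ 0ℓ
    commutativeSemigroup = record { isCommutativeSemigroup = isCommutativeSemigroup }

  open CommutativeSemigroupProperties commutativeSemigroup using (interchange)
  open ≡-Reasoning

  private variable
    A B : Set

  big : (A → C) → List A → C
  big f = foldr (λ x s → f x ∙ s) ε

  big-cong : ∀ {f g : A → C} xs → (∀ {x} → x ∈ xs → f x ≡ g x) → big f xs ≡ big g xs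
  big-cong []       _   = refl
  big-cong (x ∷ xs) f≡g = cong₂ _∙_ (f≡g (here refl)) (big-cong xs (f≡g ∘ there))

  big-map : ∀ (f : B → C) (g : A → B) xs → big f (map g xs) ≡ big (f ∘ g) xs
  big-map f g = foldr-map (λ y s → f y ∙ s) g ε

  big-ε : ∀ (xs : List A) → big (λ _ → ε) xs ≡ ε
  big-ε []       = refl
  big-ε (x ∷ xs) = trans (identityˡ _) (big-ε xs)

  big-∙ : ∀ (f g : A → C) xs → big (λ x → f x ∙ g x) xs ≡ big f xs ∙ big g xs
  big-∙ f g []       = sym (identityˡ ε)
  big-∙ f g (x ∷ xs) = begin
    (f x ∙ g x) ∙ big (λ x → f x ∙ g x) xs ≡⟨ cong ((f x ∙ g x) ∙_) (big-∙ f g xs) ⟩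
    (f x ∙ g x) ∙ (big f xs ∙ big g xs)     ≡⟨ interchange (f x) (g x) (big f xs) (big g xs) ⟩
    (f x ∙ big f xs) ∙ (g x ∙ big g xs)     ∎

  big-comm : ∀ (f : A → B → C) xs ys →
    big (λ x → big (f x) ys) xs ≡ big (λ y → big (λ x → f x y) xs) ys
  big-comm f []       ys = sym (big-ε ys)
  big-comm f (x ∷ xs) ys = begin
    big (f x) ys ∙ big (λ x → big (f x) ys) xs         ≡⟨ cong (big (f x) ys ∙_) (big-comm f xs ys) ⟩
    big (f x) ys ∙ big (λ y → big (λ x → f x y) xs) ys ≡⟨ big-∙ (f x) (λ y → big (λ x → f x y) xs) ys ⟨
    big (λ y → f x y ∙ big (λ x → f x y) xs) ys        ∎

  module _ (S : Setoid 0ℓ 0ℓ) where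
    open Setoid S using () renaming (Carrier to X; _≈_ to _≈ₛ_)
    open Enumeration S using (IsEnumeration; ↭-of-enumerations; map-enumeration)
    open SetoidPerm S using (_↭_)

    big-↭ : ∀ {f : X → C} → (∀ {x y} → x ≈ₛ y → f x ≡ f y) → ∀ {xs ys} → xs ↭ ys → big f xs ≡ big f ys
    big-↭ {f} f-cong {xs} {ys} xs↭ys = begin
      big f xs               ≡⟨ big-map id f xs ⟨
      foldr _∙_ ε (map f xs) ≡⟨ SetoidPermProp.foldr-commMonoid (setoid C) isCM
                                  (SetoidPermProp.map⁺ S (setoid C) f-cong xs↭ys) ⟩
      foldr _∙_ ε (map f ys) ≡⟨ big-map id f ys ⟩
      big f ys               ∎

    big-reindex : ∀ {f : X → C} {φ ψ : X → X} {xs} → (∀ {x y} → x ≈ₛ y → f x ≡ f y) →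
      (∀ {x y} → x ≈ₛ y → φ x ≈ₛ φ y) → (∀ {x y} → φ x ≈ₛ φ y → x ≈ₛ y) → (∀ x → φ (ψ x) ≈ₛ x) →
      IsEnumeration xs → big f xs ≡ big (f ∘ φ) xs
    big-reindex {f} {φ} {xs = xs} f-cong φ-cong φ-injective φψ≈id xs-enum = begin
      big f xs         ≡⟨ big-↭ f-cong (↭-of-enumerations xs-enum (map-enumeration φ-cong φ-injective φψ≈id xs-enum)) ⟩
      big f (map φ xs) ≡⟨ big-map f φ xs ⟩
      big (f ∘ φ) xs   ∎

module Sum = BigOperator ℚP.+-0-isCommutativeMonoid
module Product = BigOperator ℚP.*-1-isCommutativeMonoid

indicator : {P : Set} → Dec P → ℚ
indicator (yes _) = 1ℚ
indicator (no _)  = 0ℚ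

indicator-cong : {P Q : Set} (p? : Dec P) (q? : Dec Q) → (P → Q) → (Q → P) → indicator p? ≡ indicator q?
indicator-cong (yes _) (yes _) _   _   = refl
indicator-cong (no _)  (no _)  _   _   = refl
indicator-cong (yes p) (no ¬q) p⇒q _   = ⊥-elim (¬q (p⇒q p))
indicator-cong (no ¬p) (yes q) _   q⇒p = ⊥-elim (¬p (q⇒p q))

ℕtoℚ≡mkℚ : ∀ m → ℕtoℚ m ≡ mkℚ (+ m) 0 (Coprime.sym (1-coprimeTo m))
ℕtoℚ≡mkℚ m = ℚP.normalize-coprime (Coprime.sym (1-coprimeTo m))

ℕtoℚ-suc : ∀ m → ℕtoℚ (suc m) ≡ 1ℚ + ℕtoℚ m
ℕtoℚ-suc m = sym (begin
  1ℚ + ℕtoℚ m                                      ≡⟨ cong (_+_ 1ℚ) (ℕtoℚ≡mkℚ m) ⟩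
  1ℚ + mkℚ (+ m) 0 (Coprime.sym (1-coprimeTo m))   ≡⟨ cong (λ z → (+ 1 ℤ.+ z) / 1) (ℤP.*-identityʳ (+ m)) ⟩
  ℕtoℚ (suc m)                                     ∎)
  where open ≡-Reasoning

ℕtoℚ-inverseˡ : ∀ m → ((+ 1) / suc m) * ℕtoℚ (suc m) ≡ 1ℚ
ℕtoℚ-inverseˡ m rewrite ℕtoℚ≡mkℚ (suc m) | ℚP.normalize-coprime {1} {m} (1-coprimeTo (suc m)) =
  ℚP.*-inverseˡ (mkℚ (+ suc m) 0 (Coprime.sym (1-coprimeTo (suc m))))

ℕtoℚ-divide : ∀ m {p q} → ℕtoℚ (suc m) * p ≡ q → p ≡ ((+ 1) / suc m) * q
ℕtoℚ-divide m {p} {q} mp≡q = begin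
  p                                  ≡⟨ ℚP.*-identityˡ p ⟨
  1ℚ * p                             ≡⟨ cong (_* p) (ℕtoℚ-inverseˡ m) ⟨
  ((+ 1) / suc m * ℕtoℚ (suc m)) * p ≡⟨ ℚP.*-assoc ((+ 1) / suc m) (ℕtoℚ (suc m)) p ⟩
  (+ 1) / suc m * (ℕtoℚ (suc m) * p) ≡⟨ cong (_*_ ((+ 1) / suc m)) mp≡q ⟩
  (+ 1) / suc m * q                  ∎
  where open ≡-Reasoning

ℕtoℚ-cancelˡ : ∀ m {p q} → ℕtoℚ (suc m) * p ≡ ℕtoℚ (suc m) * q → p ≡ q
ℕtoℚ-cancelˡ m mp≡mq = trans (ℕtoℚ-divide m mp≡mq) (sym (ℕtoℚ-divide m refl))

module _ {A : Set} where

  sum-const : ∀ c (xs : List A) → sumℚ (λ _ → c) xs ≡ ℕtoℚ (length xs) * c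
  sum-const c []       = sym (ℚP.*-zeroˡ c)
  sum-const c (x ∷ xs) = begin
    c + sumℚ (λ _ → c) xs         ≡⟨ cong (_+_ c) (sum-const c xs) ⟩
    c + ℕtoℚ (length xs) * c      ≡⟨ cong (_+ ℕtoℚ (length xs) * c) (ℚP.*-identityˡ c) ⟨
    1ℚ * c + ℕtoℚ (length xs) * c ≡⟨ ℚP.*-distribʳ-+ c 1ℚ (ℕtoℚ (length xs)) ⟨
    (1ℚ + ℕtoℚ (length xs)) * c   ≡⟨ cong (_* c) (ℕtoℚ-suc (length xs)) ⟨
    ℕtoℚ (suc (length xs)) * c    ∎
    where open ≡-Reasoning

  sum-*ˡ : ∀ c (f : A → ℚ) xs → sumℚ (λ x → c * f x) xs ≡ c * sumℚ f xs
  sum-*ˡ c f []       = sym (ℚP.*-zeroʳ c)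
  sum-*ˡ c f (x ∷ xs) = trans (cong (_+_ (c * f x)) (sum-*ˡ c f xs)) (sym (ℚP.*-distribˡ-+ c (f x) _))

  sum-*ʳ : ∀ c (f : A → ℚ) xs → sumℚ (λ x → f x * c) xs ≡ sumℚ f xs * c
  sum-*ʳ c f []       = sym (ℚP.*-zeroˡ c)
  sum-*ʳ c f (x ∷ xs) = trans (cong (_+_ (f x * c)) (sum-*ʳ c f xs)) (sym (ℚP.*-distribʳ-+ c (f x) _))

  sum-indicator : ∀ {P : A → Set} (P? : ∀ x → Dec (P x)) xs →
    sumℚ (λ x → indicator (P? x)) xs ≡ ℕtoℚ (length (filter P? xs))
  sum-indicator P? []       = refl
  sum-indicator P? (x ∷ xs) with P? x
  ... | yes _ = trans (cong (_+_ 1ℚ) (sum-indicator P? xs)) (sym (ℕtoℚ-suc (length (filter P? xs))))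
  ... | no _  = trans (ℚP.+-identityˡ _) (sum-indicator P? xs)

  module _ (_≟_ : DecidableEquality A) (h : A → ℚ) {m : A} where

    sum-select-∉ : ∀ {xs} → All (_≢ m) xs → sumℚ (λ x → indicator (x ≟ m) * h x) xs ≡ 0ℚ
    sum-select-∉ []                    = refl
    sum-select-∉ {x ∷ xs} (x≢m ∷ xs≢m) with x ≟ m
    ... | yes x≡m = ⊥-elim (x≢m x≡m)
    ... | no _    = trans (cong₂ _+_ (ℚP.*-zeroˡ (h x)) (sum-select-∉ xs≢m)) (ℚP.+-identityˡ 0ℚ)

    sum-select : ∀ {xs} → Unique xs → m ∈ xs → sumℚ (λ x → indicator (x ≟ m) * h x) xs ≡ h m
    sum-select {x ∷ xs} (x∉xs ∷ _) (here refl) with x ≟ x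
    ... | yes _  = trans (cong₂ _+_ (ℚP.*-identityˡ (h x)) (sum-select-∉ (All.map (λ x≢y y≡x → x≢y (sym y≡x)) x∉xs)))
                         (ℚP.+-identityʳ (h x))
    ... | no x≢x = ⊥-elim (x≢x refl)
    sum-select {x ∷ xs} (x∉xs ∷ xs!) (there m∈xs) with x ≟ m
    ... | yes refl = ⊥-elim (All.lookup x∉xs m∈xs refl)
    ... | no _     = trans (cong₂ _+_ (ℚP.*-zeroˡ (h x)) (sum-select xs! m∈xs)) (ℚP.+-identityˡ (h m))

  power-filter : ∀ α {P : A → Set} (P? : ∀ x → Dec (P x)) xs →
    (1ℚ + α) ^ℚ length (filter P? xs) ≡ prodℚ (λ x → 1ℚ + α * indicator (P? x)) xs
  power-filter α P? []       = refl
  power-filter α P? (x ∷ xs) with P? x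
  ... | yes _ = cong₂ _*_ (cong (_+_ 1ℚ) (sym (ℚP.*-identityʳ α))) (power-filter α P? xs)
  ... | no _  = begin
    (1ℚ + α) ^ℚ length (filter P? xs) ≡⟨ power-filter α P? xs ⟩
    prodℚ w xs                        ≡⟨ ℚP.*-identityˡ (prodℚ w xs) ⟨
    1ℚ * prodℚ w xs                   ≡⟨ cong (_* prodℚ w xs) 1+α*0≡1 ⟨
    (1ℚ + α * 0ℚ) * prodℚ w xs        ∎
    where
    open ≡-Reasoning
    w : A → ℚ
    w x = 1ℚ + α * indicator (P? x)
    1+α*0≡1 : 1ℚ + α * 0ℚ ≡ 1ℚ
    1+α*0≡1 = trans (cong (_+_ 1ℚ) (ℚP.*-zeroʳ α)) (ℚP.+-identityʳ 1ℚ)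

module _ {n : ℕ} where

  ⟨$⟩ʳ-injective : ∀ (π : Permutation′ n) {i j} → π ⟨$⟩ʳ i ≡ π ⟨$⟩ʳ j → i ≡ j
  ⟨$⟩ʳ-injective π = Injection.injective (↔⇒↣ π)

≈-setoid : ℕ → Setoid 0ℓ 0ℓ
≈-setoid n = record
  { Carrier       = Permutation′ n
  ; _≈_           = _≈_
  ; isEquivalence = record
    { refl  = λ _ → refl
    ; sym   = λ π≈ρ i → sym (π≈ρ i)
    ; trans = λ π≈ρ ρ≈σ i → trans (π≈ρ i) (ρ≈σ i)
    }
  }

allPerms : (n : ℕ) → List (Permutation′ n)
allPerms zero    = Perm.id ∷ []
allPerms (suc n) = cartesianProductWith (insert Fin.zero) (allFin (suc n)) (allPerms n)

module _ {n : ℕ} where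

  insert-cong : ∀ {i j} {π ρ : Permutation′ n} → i ≡ j → π ≈ ρ → insert Fin.zero i π ≈ insert Fin.zero j ρ
  insert-cong i≡j π≈ρ Fin.zero                    = i≡j
  insert-cong {i} {j} {π} {ρ} i≡j π≈ρ (Fin.suc k) = begin
    insert Fin.zero i π ⟨$⟩ʳ Fin.suc k ≡⟨ insert-punchIn Fin.zero i π k ⟩
    punchIn i (π ⟨$⟩ʳ k)              ≡⟨ cong₂ punchIn i≡j (π≈ρ k) ⟩
    punchIn j (ρ ⟨$⟩ʳ k)              ≡⟨ insert-punchIn Fin.zero j ρ k ⟨
    insert Fin.zero j ρ ⟨$⟩ʳ Fin.suc k ∎
    where open ≡-Reasoning

  insert-injective : ∀ {i j} {π ρ : Permutation′ n} → insert Fin.zero i π ≈ insert Fin.zero j ρ → i ≡ j × π ≈ ρ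
  insert-injective {i} {j} {π} {ρ} eq = i≡j , λ k → punchIn-injective i _ _ (begin
    punchIn i (π ⟨$⟩ʳ k)              ≡⟨ insert-punchIn Fin.zero i π k ⟨
    insert Fin.zero i π ⟨$⟩ʳ Fin.suc k ≡⟨ eq (Fin.suc k) ⟩
    insert Fin.zero j ρ ⟨$⟩ʳ Fin.suc k ≡⟨ insert-punchIn Fin.zero j ρ k ⟩
    punchIn j (ρ ⟨$⟩ʳ k)              ≡⟨ cong (λ l → punchIn l (ρ ⟨$⟩ʳ k)) i≡j ⟨
    punchIn i (ρ ⟨$⟩ʳ k)              ∎)
    where
    open ≡-Reasoning
    i≡j : i ≡ j
    i≡j = eq Fin.zero

allPerms-isEnumeration : ∀ n → Enumeration.IsEnumeration (≈-setoid n) (allPerms n)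
allPerms-isEnumeration zero    = [] ∷ [] , λ π → here (λ ())
allPerms-isEnumeration (suc n) = unique , complete
  where
  open SetoidMembership (≈-setoid (suc n)) using () renaming (_∈_ to _∈ₛ_)
  unique : SetoidUnique.Unique (≈-setoid (suc n)) (allPerms (suc n))
  unique = SetoidUniqueProp.cartesianProductWith⁺ (setoid (Fin (suc n))) (≈-setoid n) (≈-setoid (suc n))
    (insert Fin.zero) insert-injective (UniqueProp.allFin⁺ (suc n)) (proj₁ (allPerms-isEnumeration n))
  complete : ∀ π → π ∈ₛ allPerms (suc n)
  complete π = SetoidMembershipProp.∈-resp-≈ (≈-setoid (suc n))
    {x = insert Fin.zero (π ⟨$⟩ʳ Fin.zero) (remove Fin.zero π)} {π} (insert-remove Fin.zero π)
    (SetoidMembershipProp.∈-cartesianProductWith⁺ (setoid (Fin (suc n))) (≈-setoid n) (≈-setoid (suc n))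
      insert-cong (∈-allFin (π ⟨$⟩ʳ Fin.zero)) (proj₂ (allPerms-isEnumeration n) (remove Fin.zero π)))

module _ {n : ℕ} {f : Permutation′ n → ℚ} (f-cong : ∀ {ρ ρ′} → ρ ≈ ρ′ → f ρ ≡ f ρ′) (π : Permutation′ n) where

  sum-allPerms-∘ₚˡ : sumℚ f (allPerms n) ≡ sumℚ (λ ρ → f (π ∘ₚ ρ)) (allPerms n)
  sum-allPerms-∘ₚˡ = Sum.big-reindex (≈-setoid n) {ψ = flip π ∘ₚ_} f-cong
    (λ ρ≈ρ′ i → ρ≈ρ′ (π ⟨$⟩ʳ i))
    (λ {ρ} {ρ′} πρ≈πρ′ i → subst (λ j → ρ ⟨$⟩ʳ j ≡ ρ′ ⟨$⟩ʳ j) (inverseʳ π) (πρ≈πρ′ (π ⟨$⟩ˡ i)))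
    (λ ρ i → cong (ρ ⟨$⟩ʳ_) (inverseˡ π))
    (allPerms-isEnumeration n)

  sum-allPerms-∘ₚʳ : sumℚ f (allPerms n) ≡ sumℚ (λ ρ → f (ρ ∘ₚ π)) (allPerms n)
  sum-allPerms-∘ₚʳ = Sum.big-reindex (≈-setoid n) {ψ = _∘ₚ flip π} f-cong
    (λ ρ≈ρ′ i → cong (π ⟨$⟩ʳ_) (ρ≈ρ′ i))
    (λ ρπ≈ρ′π i → ⟨$⟩ʳ-injective π (ρπ≈ρ′π i))
    (λ ρ i → inverseʳ π)
    (allPerms-isEnumeration n)

module _ {n : ℕ} (i j : Fin n) where

  transpose-i : PC.transpose i j i ≡ j
  transpose-i rewrite dec-true (i ≟ᶠ i) refl = refl

  transpose-other : ∀ {k} → k ≢ i → k ≢ j → PC.transpose i j k ≡ k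
  transpose-other {k} k≢i k≢j rewrite dec-false (k ≟ᶠ i) k≢i | dec-false (k ≟ᶠ j) k≢j = refl

  transpose-j : PC.transpose i j j ≡ i
  transpose-j = by-cases (j ≟ᶠ i)
    where
    by-cases : Dec (j ≡ i) → PC.transpose i j j ≡ i
    by-cases (yes refl) = transpose-i
    by-cases (no j≢i) rewrite dec-false (j ≟ᶠ i) j≢i | dec-true (j ≟ᶠ j) refl = refl

  transpose-involutive : ∀ k → PC.transpose i j (PC.transpose i j k) ≡ k
  transpose-involutive k = by-cases (k ≟ᶠ i) (k ≟ᶠ j)
    where
    by-cases : Dec (k ≡ i) → Dec (k ≡ j) → PC.transpose i j (PC.transpose i j k) ≡ k
    by-cases (yes refl) _          = trans (cong (PC.transpose i j) transpose-i) transpose-j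
    by-cases (no _)     (yes refl) = trans (cong (PC.transpose i j) transpose-j) transpose-i
    by-cases (no k≢i)   (no k≢j)   = trans (cong (PC.transpose i j) (transpose-other k≢i k≢j)) (transpose-other k≢i k≢j)

  transpose-closed : ∀ {P : Fin n → Set} {k} → P i → P j → P k → P (PC.transpose i j k)
  transpose-closed {P} {k} pi pj pk = by-cases (k ≟ᶠ i) (k ≟ᶠ j)
    where
    by-cases : Dec (k ≡ i) → Dec (k ≡ j) → P (PC.transpose i j k)
    by-cases (yes refl) _          = subst P (sym transpose-i) pj
    by-cases (no _)     (yes refl) = subst P (sym transpose-j) pi
    by-cases (no k≢i)   (no k≢j)   = subst P (sym (transpose-other k≢i k≢j)) pk

module _ {A : Set} {P Q : A → Set} (P? : ∀ x → Dec (P x)) (Q? : ∀ x → Dec (Q x)) (P⇒Q : ∀ {x} → P x → Q x) where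

  length-filter-mono-≤ : ∀ xs → length (filter P? xs) ℕ.≤ length (filter Q? xs)
  length-filter-mono-≤ []       = z≤n
  length-filter-mono-≤ (x ∷ xs) with P? x | Q? x
  ... | yes _  | yes _  = s≤s (length-filter-mono-≤ xs)
  ... | yes px | no ¬qx = ⊥-elim (¬qx (P⇒Q px))
  ... | no _   | yes _  = ℕP.m≤n⇒m≤1+n (length-filter-mono-≤ xs)
  ... | no _   | no _   = length-filter-mono-≤ xs

  length-filter-mono-< : ∀ {y} xs → y ∈ xs → Q y → ¬ P y → length (filter P? xs) ℕ.< length (filter Q? xs)
  length-filter-mono-< (x ∷ xs) (here refl) qy ¬py with P? x | Q? x
  ... | yes py | _      = ⊥-elim (¬py py)
  ... | no _   | yes _  = s≤s (length-filter-mono-≤ xs)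
  ... | no _   | no ¬qy = ⊥-elim (¬qy qy)
  length-filter-mono-< (x ∷ xs) (there y∈xs) qy ¬py with P? x | Q? x
  ... | yes _  | yes _  = s≤s (length-filter-mono-< xs y∈xs qy ¬py)
  ... | yes px | no ¬qx = ⊥-elim (¬qx (P⇒Q px))
  ... | no _   | yes _  = ℕP.m≤n⇒m≤1+n (length-filter-mono-< xs y∈xs qy ¬py)
  ... | no _   | no _   = length-filter-mono-< xs y∈xs qy ¬py

Descendant : {n : ℕ} → Forest n → Fin n → Fin n → Set
Descendant F v w = v ≡ w ⊎ ProperDesc F v w

module ForestProperties {n : ℕ} (F : Forest n) where

  private
    par : Fin n → Maybe (Fin n)
    par = parent F

  up-suc : ∀ k w → up par (suc k) w ≡ (up par k w >>= par)
  up-suc k w with up par k w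
  ... | just _  = refl
  ... | nothing = refl

  up-+ : ∀ k m w → up par (k ℕ.+ m) w ≡ (up par m w >>= up par k)
  up-+ zero    m w with up par m w
  ... | just _  = refl
  ... | nothing = refl
  up-+ (suc k) m w = begin
    up par (suc (k ℕ.+ m)) w            ≡⟨ up-suc (k ℕ.+ m) w ⟩
    (up par (k ℕ.+ m) w >>= par)        ≡⟨ cong (_>>= par) (up-+ k m w) ⟩
    ((up par m w >>= up par k) >>= par) ≡⟨ >>=-assoc (up par m w) ⟩
    (up par m w >>= up par (suc k))     ∎
    where
    open ≡-Reasoning
    >>=-assoc : ∀ z → ((z >>= up par k) >>= par) ≡ (z >>= up par (suc k))
    >>=-assoc nothing  = refl
    >>=-assoc (just u) = sym (up-suc k u)

  up-beyond-depth : ∀ {k} w → n ℕ.≤ k → up par k w ≡ nothing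
  up-beyond-depth {k} w n≤k = begin
    up par k w                            ≡⟨ cong (λ i → up par i w) (ℕP.m∸n+n≡m n≤k) ⟨
    up par (k ℕ.∸ n ℕ.+ n) w              ≡⟨ up-+ (k ℕ.∸ n) n w ⟩
    (up par n w >>= up par (k ℕ.∸ n))     ≡⟨ cong (_>>= up par (k ℕ.∸ n)) (acyclic F w) ⟩
    nothing                               ∎
    where open ≡-Reasoning

  up-just⇒< : ∀ {k w v} → up par k w ≡ just v → k ℕ.< n
  up-just⇒< {k} {w} up≡just with ℕP.<-≤-connex k n
  ... | inj₁ k<n = k<n
  ... | inj₂ n≤k with () ← trans (sym up≡just) (up-beyond-depth w n≤k)

  properDesc-intro : ∀ m {v w} → up par (suc m) w ≡ just v → ProperDesc F v w
  properDesc-intro m {v} {w} up≡just =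
    fromℕ< m<n , subst (λ i → up par (suc i) w ≡ just v) (sym (toℕ-fromℕ< m<n)) up≡just
    where
    m<n : m ℕ.< n
    m<n = ℕP.<-trans (ℕP.n<1+n m) (up-just⇒< up≡just)

  properDesc-trans : ∀ {u v w} → ProperDesc F u v → ProperDesc F v w → ProperDesc F u w
  properDesc-trans {u} {v} {w} (i , v↑u) (j , w↑v) = properDesc-intro (toℕ i ℕ.+ suc (toℕ j)) (begin
    up par (suc (toℕ i) ℕ.+ suc (toℕ j)) w            ≡⟨ up-+ (suc (toℕ i)) (suc (toℕ j)) w ⟩
    (up par (suc (toℕ j)) w >>= up par (suc (toℕ i))) ≡⟨ cong (_>>= up par (suc (toℕ i))) w↑v ⟩
    up par (suc (toℕ i)) v                            ≡⟨ v↑u ⟩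
    just u                                            ∎)
    where open ≡-Reasoning

  properDesc-irrefl : ∀ {v} → ¬ ProperDesc F v v
  properDesc-irrefl {v} (i , v↑v) = case trans (sym (cycle n)) (up-beyond-depth v (ℕP.m≤m*n n (suc (toℕ i)))) of λ ()
    where
    cycle : ∀ j → up par (j ℕ.* suc (toℕ i)) v ≡ just v
    cycle zero    = refl
    cycle (suc j) = begin
      up par (suc (toℕ i) ℕ.+ j ℕ.* suc (toℕ i)) v             ≡⟨ up-+ (suc (toℕ i)) (j ℕ.* suc (toℕ i)) v ⟩
      (up par (j ℕ.* suc (toℕ i)) v >>= up par (suc (toℕ i)))  ≡⟨ cong (_>>= up par (suc (toℕ i))) (cycle j) ⟩
      up par (suc (toℕ i)) v                                   ≡⟨ v↑v ⟩
      just v                                                   ∎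
      where open ≡-Reasoning

  higher-ancestor : ∀ m k {w a b} → up par (suc m) w ≡ just a → up par (suc (suc (m ℕ.+ k))) w ≡ just b →
    ProperDesc F b a
  higher-ancestor m k {w} {a} {b} w↑a w↑b = properDesc-intro k (begin
    up par (suc k) a                      ≡⟨ cong (_>>= up par (suc k)) w↑a ⟨
    (up par (suc m) w >>= up par (suc k)) ≡⟨ up-+ (suc k) (suc m) w ⟨
    up par (suc k ℕ.+ suc m) w            ≡⟨ cong (λ i → up par (suc i) w) (trans (ℕP.+-suc k m) (cong suc (ℕP.+-comm k m))) ⟩
    up par (suc (suc (m ℕ.+ k))) w        ≡⟨ w↑b ⟩
    just b                                ∎)
    where open ≡-Reasoning

  ancestors-comparable : ∀ {u v w} → ProperDesc F u w → ProperDesc F v w →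
    u ≡ v ⊎ ProperDesc F u v ⊎ ProperDesc F v u
  ancestors-comparable {u} {v} {w} (i , w↑u) (j , w↑v) = by-heights (compare (toℕ i) (toℕ j)) w↑u w↑v
    where
    by-heights : ∀ {p q} → ℕ.Ordering p q → up par (suc p) w ≡ just u → up par (suc q) w ≡ just v →
      u ≡ v ⊎ ProperDesc F u v ⊎ ProperDesc F v u
    by-heights (equal _)     w↑u w↑v = inj₁ (MaybeP.just-injective (trans (sym w↑u) w↑v))
    by-heights (less p k)    w↑u w↑v = inj₂ (inj₂ (higher-ancestor p k w↑u w↑v))
    by-heights (greater q k) w↑u w↑v = inj₂ (inj₁ (higher-ancestor q k w↑v w↑u))

  hook-< : ∀ {v w} → ProperDesc F v w → hook F w ℕ.< hook F v
  hook-< {v} {w} v<w = s≤s (length-filter-mono-< (properDesc? F w) (properDesc? F v)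
    (properDesc-trans v<w) (allFin n) (∈-allFin w) v<w properDesc-irrefl)

  module _ (σ : Permutation′ n) (σ-aut : IsAutomorphism F σ) where

    up-automorphism : ∀ k v → up par k (σ ⟨$⟩ʳ v) ≡ Maybe.map (σ ⟨$⟩ʳ_) (up par k v)
    up-automorphism zero    v = refl
    up-automorphism (suc k) v = begin
      up par (suc k) (σ ⟨$⟩ʳ v)                  ≡⟨ up-suc k (σ ⟨$⟩ʳ v) ⟩
      (up par k (σ ⟨$⟩ʳ v) >>= par)              ≡⟨ cong (_>>= par) (up-automorphism k v) ⟩
      (Maybe.map (σ ⟨$⟩ʳ_) (up par k v) >>= par) ≡⟨ map->>= (up par k v) ⟩
      Maybe.map (σ ⟨$⟩ʳ_) (up par k v >>= par)   ≡⟨ cong (Maybe.map (σ ⟨$⟩ʳ_)) (up-suc k v) ⟨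
      Maybe.map (σ ⟨$⟩ʳ_) (up par (suc k) v)     ∎
      where
      open ≡-Reasoning
      map->>= : ∀ z → (Maybe.map (σ ⟨$⟩ʳ_) z >>= par) ≡ Maybe.map (σ ⟨$⟩ʳ_) (z >>= par)
      map->>= nothing  = refl
      map->>= (just u) = σ-aut u

    properDesc-automorphism : ∀ {v w} → ProperDesc F v w → ProperDesc F (σ ⟨$⟩ʳ v) (σ ⟨$⟩ʳ w)
    properDesc-automorphism {v} {w} (i , w↑v) =
      i , trans (up-automorphism (suc (toℕ i)) w) (cong (Maybe.map (σ ⟨$⟩ʳ_)) w↑v)

    properDesc-automorphism⁻ : ∀ {v w} → ProperDesc F (σ ⟨$⟩ʳ v) (σ ⟨$⟩ʳ w) → ProperDesc F v w
    properDesc-automorphism⁻ {v} {w} (i , σw↑σv) =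
      i , MaybeP.map-injective (⟨$⟩ʳ-injective σ) (trans (sym (up-automorphism (suc (toℕ i)) w)) σw↑σv)

module ProperVertices {n : ℕ} (F : Forest n) where
  open ForestProperties F

  descendant? : ∀ v w → Dec (Descendant F v w)
  descendant? v w = (v ≟ᶠ w) ⊎-dec properDesc? F v w

  descendants : Fin n → List (Fin n)
  descendants v = v ∷ filter (properDesc? F v) (allFin n)

  ∈-descendants⁺ : ∀ {v w} → Descendant F v w → w ∈ descendants v
  ∈-descendants⁺ (inj₁ refl) = here refl
  ∈-descendants⁺ (inj₂ v<w)  = there (∈-filter⁺ (properDesc? F _) (∈-allFin _) v<w)

  ∈-descendants⁻ : ∀ {v w} → w ∈ descendants v → Descendant F v w
  ∈-descendants⁻ (here refl)  = inj₁ refl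
  ∈-descendants⁻ (there w∈ds) = inj₂ (proj₂ (∈-filter⁻ (properDesc? F _) {xs = allFin n} w∈ds))

  descendants-unique : ∀ v → Unique (descendants v)
  descendants-unique v = All.tabulate v∉ ∷ UniqueProp.filter⁺ (properDesc? F v) (UniqueProp.allFin⁺ n)
    where
    v∉ : ∀ {w} → w ∈ filter (properDesc? F v) (allFin n) → v ≢ w
    v∉ w∈ refl = properDesc-irrefl (proj₂ (∈-filter⁻ (properDesc? F v) {xs = allFin n} w∈))

  descendant-≢ : ∀ {v w} → Descendant F v w → v ≢ w → ProperDesc F v w
  descendant-≢ (inj₁ v≡w) v≢w = ⊥-elim (v≢w v≡w)
  descendant-≢ (inj₂ v<w) _   = v<w

  properDesc-descendant : ∀ {u v w} → ProperDesc F u v → Descendant F v w → ProperDesc F u w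
  properDesc-descendant u<v (inj₁ refl) = u<v
  properDesc-descendant u<v (inj₂ v<w)  = properDesc-trans u<v v<w

  ancestor-of-subtree : ∀ {y j u} → ¬ Descendant F y j → ProperDesc F j u → Descendant F y u → ProperDesc F j y
  ancestor-of-subtree y↛j j<u (inj₁ refl) = j<u
  ancestor-of-subtree y↛j j<u (inj₂ y<u) with ancestors-comparable j<u y<u
  ... | inj₁ j≡y        = ⊥-elim (y↛j (inj₁ (sym j≡y)))
  ... | inj₂ (inj₁ j<y) = j<y
  ... | inj₂ (inj₂ y<j) = ⊥-elim (y↛j (inj₂ y<j))

  Proper-resp-≈ : ∀ {L L′ v} → L ≈ L′ → Proper F L v → Proper F L′ v
  Proper-resp-≈ {v = v} L≈L′ proper w v<w = subst₂ Fin._<_ (L≈L′ v) (L≈L′ w) (proper w v<w)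

  -- (π ∘ₚ L) ⟨$⟩ʳ v = L ⟨$⟩ʳ (π ⟨$⟩ʳ v): vertex v receives the label of π v.
  Proper-∘ₚ : ∀ {L π j} → π ⟨$⟩ʳ j ≡ j → (∀ {u} → ProperDesc F j u → ProperDesc F j (π ⟨$⟩ʳ u)) →
    Proper F L j → Proper F (π ∘ₚ L) j
  Proper-∘ₚ {L} πj≡j π-closed proper u j<u =
    subst (λ k → L ⟨$⟩ʳ k Fin.< L ⟨$⟩ʳ _) (sym πj≡j) (proper _ (π-closed j<u))

  indicator-proper-cong : ∀ {L L′} v → L ≈ L′ → indicator (proper? F L v) ≡ indicator (proper? F L′ v)
  indicator-proper-cong {L} {L′} v L≈L′ = indicator-cong (proper? F L v) (proper? F L′ v)
    (Proper-resp-≈ {L} {L′} L≈L′) (Proper-resp-≈ {L′} {L} (λ i → sym (L≈L′ i)))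

  weight : ℚ → Labeling n → Fin n → ℚ
  weight α L v = 1ℚ + α * indicator (proper? F L v)

  HasLeastLabel : Labeling n → Fin n → Fin n → Set
  HasLeastLabel L y w = ∀ u → Descendant F y u → u ≢ w → L ⟨$⟩ʳ w Fin.< L ⟨$⟩ʳ u

  module _ {y w : Fin n} (y→w : Descendant F y w) where

    private
      τ : Fin n → Fin n
      τ = PC.transpose y w

      τ-descendant : ∀ {u} → Descendant F y u → Descendant F y (τ u)
      τ-descendant = transpose-closed y w {Descendant F y} (inj₁ refl) y→w

    transpose-fixes-outside : ∀ {j} → ¬ Descendant F y j → τ j ≡ j
    transpose-fixes-outside y↛j = transpose-other y w (λ j≡y → y↛j (inj₁ (sym j≡y))) λ { refl → y↛j y→w }

    transpose-preserves-properDesc : ∀ {j u} → ¬ Descendant F y j → ProperDesc F j u → ProperDesc F j (τ u)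
    transpose-preserves-properDesc {j} {u} y↛j j<u with descendant? y u
    ... | yes y→u = properDesc-descendant (ancestor-of-subtree y↛j j<u y→u) (τ-descendant y→u)
    ... | no y↛u  = subst (ProperDesc F j) (sym (transpose-fixes-outside y↛u)) j<u

    proper-transpose-outside : ∀ {L j} → ¬ Descendant F y j → Proper F L j → Proper F (transpose y w ∘ₚ L) j
    proper-transpose-outside {L} y↛j =
      Proper-∘ₚ {L} {transpose y w} (transpose-fixes-outside y↛j) (transpose-preserves-properDesc y↛j)

    proper-transpose-outside⁻ : ∀ {L j} → ¬ Descendant F y j → Proper F (transpose y w ∘ₚ L) j → Proper F L j
    proper-transpose-outside⁻ {L} y↛j proper =
      Proper-resp-≈ {transpose y w ∘ₚ (transpose y w ∘ₚ L)} {L} (λ v → cong (L ⟨$⟩ʳ_) (transpose-involutive y w v))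
        (proper-transpose-outside {transpose y w ∘ₚ L} y↛j proper)

    proper-transpose⇒least : ∀ {L} → Proper F (transpose y w ∘ₚ L) y → HasLeastLabel L y w
    proper-transpose⇒least {L} proper u y→u u≢w =
      subst₂ (λ a b → L ⟨$⟩ʳ a Fin.< L ⟨$⟩ʳ b) (transpose-i y w) (transpose-involutive y w u)
        (proper (τ u) (descendant-≢ (τ-descendant y→u) y≢τu))
      where
      y≢τu : y ≢ τ u
      y≢τu y≡τu = u≢w (trans (sym (transpose-involutive y w u)) (trans (cong τ (sym y≡τu)) (transpose-i y w)))

    least⇒proper-transpose : ∀ {L} → HasLeastLabel L y w → Proper F (transpose y w ∘ₚ L) y
    least⇒proper-transpose {L} least u y<u =
      subst (λ a → L ⟨$⟩ʳ a Fin.< L ⟨$⟩ʳ τ u) (sym (transpose-i y w)) (least (τ u) (τ-descendant (inj₂ y<u)) τu≢w)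
      where
      τu≢w : τ u ≢ w
      τu≢w τu≡w = properDesc-irrefl (subst (ProperDesc F y) u≡y y<u)
        where
        u≡y : u ≡ y
        u≡y = trans (sym (transpose-involutive y w u)) (trans (cong τ τu≡w) (transpose-j y w))

  module _ (L : Labeling n) (y : Fin n) where
    open import Data.List.Extrema (FinP.≤-totalOrder n) using (argmin; argmin-all; f[argmin]≤f[⊤]; f[argmin]≤f[xs])

    private
      proper-descendants : List (Fin n)
      proper-descendants = filter (properDesc? F y) (allFin n)

    leastLabelled : Fin n
    leastLabelled = argmin (L ⟨$⟩ʳ_) y proper-descendants

    leastLabelled-descendant : Descendant F y leastLabelled
    leastLabelled-descendant = argmin-all (L ⟨$⟩ʳ_) {P = Descendant F y} (inj₁ refl)
      (All.tabulate (λ u∈ → inj₂ (proj₂ (∈-filter⁻ (properDesc? F y) {xs = allFin n} u∈))))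

    leastLabelled-≤ : ∀ {u} → Descendant F y u → L ⟨$⟩ʳ leastLabelled Fin.≤ L ⟨$⟩ʳ u
    leastLabelled-≤ (inj₁ refl) = f[argmin]≤f[⊤] {f = L ⟨$⟩ʳ_} y proper-descendants
    leastLabelled-≤ (inj₂ y<u)  = All.lookup (f[argmin]≤f[xs] {f = L ⟨$⟩ʳ_} y proper-descendants)
      (∈-filter⁺ (properDesc? F y) (∈-allFin _) y<u)

    leastLabelled-least : HasLeastLabel L y leastLabelled
    leastLabelled-least u y→u u≢m =
      FinP.≤∧≢⇒< (leastLabelled-≤ y→u) (λ Lm≡Lu → u≢m (sym (⟨$⟩ʳ-injective L Lm≡Lu)))

    least-unique : ∀ {w} → Descendant F y w → HasLeastLabel L y w → w ≡ leastLabelled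
    least-unique {w} y→w least with w ≟ᶠ leastLabelled
    ... | yes w≡m = w≡m
    ... | no w≢m  = ⊥-elim (FinP.<-asym (least leastLabelled leastLabelled-descendant (w≢m ∘ sym))
                                       (leastLabelled-least w y→w w≢m))

  indicator-proper-transpose : ∀ {L y w} → Descendant F y w →
    indicator (proper? F (transpose y w ∘ₚ L) y) ≡ indicator (w ≟ᶠ leastLabelled L y)
  indicator-proper-transpose {L} {y} {w} y→w = indicator-cong (proper? F (transpose y w ∘ₚ L) y) (w ≟ᶠ leastLabelled L y)
    (least-unique L y y→w ∘ proper-transpose⇒least y→w {L})
    (λ { refl → least⇒proper-transpose y→w {L} (leastLabelled-least L y) })

module LabelingSums {n : ℕ} (F : Forest n) where
  open ForestProperties F
  open ProperVertices F

  private
    Ls : List (Labeling n)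
    Ls = allPerms n

  module _ (y : Fin n) {g : Labeling n → ℚ} (g-cong : ∀ {L L′} → L ≈ L′ → g L ≡ g L′)
           (g-invariant : ∀ {L w} → Descendant F y w → g (transpose y w ∘ₚ L) ≡ g L) where

    private
      S : ℚ
      S = sumℚ (λ L → indicator (proper? F L y) * g L) Ls

      isLeast : Fin n → Labeling n → ℚ
      isLeast w L = indicator (w ≟ᶠ leastLabelled L y)

      S-via-transpose : ∀ {w} → Descendant F y w → S ≡ sumℚ (λ L → isLeast w L * g L) Ls
      S-via-transpose {w} y→w = begin
        S
          ≡⟨ sum-allPerms-∘ₚˡ (λ {L} {L′} L≈L′ → cong₂ _*_ (indicator-proper-cong {L} {L′} y L≈L′) (g-cong L≈L′))
                              (transpose y w) ⟩
        sumℚ (λ L → indicator (proper? F (transpose y w ∘ₚ L) y) * g (transpose y w ∘ₚ L)) Ls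
          ≡⟨ Sum.big-cong Ls (λ {L} _ → cong₂ _*_ (indicator-proper-transpose {L} y→w) (g-invariant {L} y→w)) ⟩
        sumℚ (λ L → isLeast w L * g L) Ls
          ∎
        where open ≡-Reasoning

    sum-proper : sumℚ (λ L → indicator (proper? F L y) * g L) (allPerms n) ≡ ((+ 1) / hook F y) * sumℚ g (allPerms n)
    sum-proper = ℕtoℚ-divide (length (filter (properDesc? F y) (allFin n))) (begin
      ℕtoℚ (hook F y) * S
        ≡⟨ sum-const S (descendants y) ⟨
      sumℚ (λ _ → S) (descendants y)
        ≡⟨ Sum.big-cong (descendants y) (S-via-transpose ∘ ∈-descendants⁻) ⟩
      sumℚ (λ w → sumℚ (λ L → isLeast w L * g L) Ls) (descendants y)
        ≡⟨ Sum.big-comm (λ w L → isLeast w L * g L) (descendants y) Ls ⟩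
      sumℚ (λ L → sumℚ (λ w → isLeast w L * g L) (descendants y)) Ls
        ≡⟨ Sum.big-cong Ls (λ {L} _ → sum-select _≟ᶠ_ (λ _ → g L) (descendants-unique y)
                                        (∈-descendants⁺ (leastLabelled-descendant L y))) ⟩
      sumℚ g Ls
        ∎)
      where open ≡-Reasoning

  module ByHook = Sort (On.decTotalOrder ℕP.≤-decTotalOrder (hook F))

  topologicalOrder : List (Fin n)
  topologicalOrder = ByHook.sort (allFin n)

  topologicalOrder-↭ : SetoidPerm._↭_ (setoid (Fin n)) topologicalOrder (allFin n)
  topologicalOrder-↭ = PropositionalPerm.↭⇒↭ₛ (ByHook.sort-↭ (allFin n))

  topologicalOrder-descendantsFirst : AllPairs (λ a b → ¬ Descendant F a b) topologicalOrder
  topologicalOrder-descendantsFirst = AllPairs.zipWith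
    (λ { (a≢b , hook-a≤hook-b) → λ { (inj₁ a≡b) → a≢b a≡b ; (inj₂ a<b) → ℕP.<⇒≱ (hook-< a<b) hook-a≤hook-b } })
    (unique , Linked⇒AllPairs ℕP.≤-trans (ByHook.sort-↗ (allFin n)))
    where
    unique : Unique topologicalOrder
    unique = SetoidPermProp.Unique-resp-↭ (setoid (Fin n)) (SetoidPerm.↭-sym (setoid (Fin n)) topologicalOrder-↭)
      (UniqueProp.allFin⁺ n)

  module _ (α : ℚ) where

    hookFactor : Fin n → ℚ
    hookFactor v = 1ℚ + α * ((+ 1) / hook F v)

    private
      N : ℚ
      N = sumℚ (λ _ → 1ℚ) Ls

      expand : ∀ i p → (1ℚ + α * i) * p ≡ p + α * (i * p)
      expand = solve 3 (λ a i p → (con 1ℚ :+ a :* i) :* p := p :+ a :* (i :* p)) refl α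
        where open +-*-Solver

      collect : ∀ q m x → m * x + α * (q * (m * x)) ≡ m * ((1ℚ + α * q) * x)
      collect = solve 4 (λ a q m x → m :* x :+ a :* (q :* (m :* x)) := m :* ((con 1ℚ :+ a :* q) :* x)) refl α
        where open +-*-Solver

    sum-weights : ∀ ys → AllPairs (λ a b → ¬ Descendant F a b) ys →
      sumℚ (λ L → prodℚ (weight α L) ys) (allPerms n) ≡ sumℚ (λ _ → 1ℚ) (allPerms n) * prodℚ hookFactor ys
    sum-weights []       []             = sym (ℚP.*-identityʳ N)
    sum-weights (y ∷ ys) (y↛ys ∷ ys-ok) = begin
      sumℚ (λ L → weight α L y * P L) Ls
        ≡⟨ Sum.big-cong Ls (λ {L} _ → expand (indicator (proper? F L y)) (P L)) ⟩
      sumℚ (λ L → P L + α * (indicator (proper? F L y) * P L)) Ls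
        ≡⟨ Sum.big-∙ P (λ L → α * (indicator (proper? F L y) * P L)) Ls ⟩
      T + sumℚ (λ L → α * (indicator (proper? F L y) * P L)) Ls
        ≡⟨ cong (_+_ T) (sum-*ˡ α (λ L → indicator (proper? F L y) * P L) Ls) ⟩
      T + α * sumℚ (λ L → indicator (proper? F L y) * P L) Ls
        ≡⟨ cong (λ s → T + α * s) (sum-proper y (λ {L} {L′} → P-cong {L} {L′}) (λ {L} → P-invariant {L})) ⟩
      T + α * ((+ 1) / hook F y * T)
        ≡⟨ cong (λ t → t + α * ((+ 1) / hook F y * t)) (sum-weights ys ys-ok) ⟩
      N * X + α * ((+ 1) / hook F y * (N * X))
        ≡⟨ collect ((+ 1) / hook F y) N X ⟩
      N * (hookFactor y * X)
        ∎
      where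
      open ≡-Reasoning
      P : Labeling n → ℚ
      P L = prodℚ (weight α L) ys
      T X : ℚ
      T = sumℚ P Ls
      X = prodℚ hookFactor ys

      P-cong : ∀ {L L′} → L ≈ L′ → P L ≡ P L′
      P-cong {L} {L′} L≈L′ = Product.big-cong ys (λ {v} _ → cong (λ z → 1ℚ + α * z) (indicator-proper-cong {L} {L′} v L≈L′))

      P-invariant : ∀ {L w} → Descendant F y w → P (transpose y w ∘ₚ L) ≡ P L
      P-invariant {L} {w} y→w = Product.big-cong ys (λ {j} j∈ys → cong (λ z → 1ℚ + α * z)
        (indicator-cong (proper? F (transpose y w ∘ₚ L) j) (proper? F L j)
          (proper-transpose-outside⁻ y→w {L} (All.lookup y↛ys j∈ys))
          (proper-transpose-outside y→w {L} (All.lookup y↛ys j∈ys))))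

    sum-power-prop : sumℚ (λ L → (1ℚ + α) ^ℚ prop F L) (allPerms n) ≡
      sumℚ (λ _ → 1ℚ) (allPerms n) * prodℚ hookFactor (allFin n)
    sum-power-prop = begin
      sumℚ (λ L → (1ℚ + α) ^ℚ prop F L) Ls
        ≡⟨ Sum.big-cong Ls (λ {L} _ → power-filter α (proper? F L) (allFin n)) ⟩
      sumℚ (λ L → prodℚ (weight α L) (allFin n)) Ls
        ≡⟨ Sum.big-cong Ls (λ {L} _ → Product.big-↭ (setoid (Fin n)) (cong (weight α L)) topologicalOrder-↭) ⟨
      sumℚ (λ L → prodℚ (weight α L) topologicalOrder) Ls
        ≡⟨ sum-weights topologicalOrder topologicalOrder-descendantsFirst ⟩
      N * prodℚ hookFactor topologicalOrder
        ≡⟨ cong (_*_ N) (Product.big-↭ (setoid (Fin n)) (cong hookFactor) topologicalOrder-↭) ⟩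
      N * prodℚ hookFactor (allFin n)
        ∎
      where open ≡-Reasoning

module Isomorphisms {n : ℕ} (F : Forest n) where
  open ForestProperties F
  open ProperVertices F using (weight)

  IsoLab-reflexive : ∀ {L L′} → L ≈ L′ → IsoLab F L L′
  IsoLab-reflexive L≈L′ = Perm.id , (λ v → sym (MaybeP.map-id (parent F v))) , (λ v → sym (L≈L′ v))

  IsoLab-sym : ∀ {L L′} → IsoLab F L L′ → IsoLab F L′ L
  IsoLab-sym {L} {L′} (σ , σ-aut , L′σ≡L) =
    flip σ , σ⁻¹-aut , λ v → trans (sym (L′σ≡L (σ ⟨$⟩ˡ v))) (cong (L′ ⟨$⟩ʳ_) (inverseʳ σ))
    where
    σ⁻¹-aut : IsAutomorphism F (flip σ)
    σ⁻¹-aut v = sym (begin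
      Maybe.map (σ ⟨$⟩ˡ_) (parent F v)
        ≡⟨ cong (Maybe.map (σ ⟨$⟩ˡ_) ∘ parent F) (inverseʳ σ) ⟨
      Maybe.map (σ ⟨$⟩ˡ_) (parent F (σ ⟨$⟩ʳ (σ ⟨$⟩ˡ v)))
        ≡⟨ cong (Maybe.map (σ ⟨$⟩ˡ_)) (σ-aut (σ ⟨$⟩ˡ v)) ⟩
      Maybe.map (σ ⟨$⟩ˡ_) (Maybe.map (σ ⟨$⟩ʳ_) (parent F (σ ⟨$⟩ˡ v)))
        ≡⟨ MaybeP.map-∘ (parent F (σ ⟨$⟩ˡ v)) ⟨
      Maybe.map (λ u → σ ⟨$⟩ˡ (σ ⟨$⟩ʳ u)) (parent F (σ ⟨$⟩ˡ v))
        ≡⟨ MaybeP.map-id-local (MaybeAll.universal (λ _ → inverseˡ σ) _) ⟩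
      parent F (σ ⟨$⟩ˡ v)
        ∎)
      where open ≡-Reasoning

  IsoLab-trans : ∀ {L L′ L″} → IsoLab F L L′ → IsoLab F L′ L″ → IsoLab F L L″
  IsoLab-trans (σ , σ-aut , L′σ≡L) (ρ , ρ-aut , L″ρ≡L′) =
    σ ∘ₚ ρ ,
    (λ v → trans (ρ-aut (σ ⟨$⟩ʳ v)) (trans (cong (Maybe.map (ρ ⟨$⟩ʳ_)) (σ-aut v)) (sym (MaybeP.map-∘ (parent F v))))) ,
    λ v → trans (L″ρ≡L′ (σ ⟨$⟩ʳ v)) (L′σ≡L v)

  IsoLab-∘ₚ : ∀ {L L′} π → IsoLab F L L′ → IsoLab F (L ∘ₚ π) (L′ ∘ₚ π)
  IsoLab-∘ₚ π (σ , σ-aut , L′σ≡L) = σ , σ-aut , λ v → cong (π ⟨$⟩ʳ_) (L′σ≡L v)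

  module _ {L L′ : Labeling n} (σ : Permutation′ n) (σ-aut : IsAutomorphism F σ)
           (L′σ≡L : ∀ v → L′ ⟨$⟩ʳ (σ ⟨$⟩ʳ v) ≡ L ⟨$⟩ʳ v) where

    proper-automorphism : ∀ {v} → Proper F L v → Proper F L′ (σ ⟨$⟩ʳ v)
    proper-automorphism {v} proper u σv<u =
      subst₂ Fin._<_ (sym (L′σ≡L v)) (trans (sym (L′σ≡L (σ ⟨$⟩ˡ u))) (cong (L′ ⟨$⟩ʳ_) (inverseʳ σ)))
        (proper (σ ⟨$⟩ˡ u) (properDesc-automorphism⁻ σ σ-aut (subst (ProperDesc F (σ ⟨$⟩ʳ v)) (sym (inverseʳ σ)) σv<u)))

    proper-automorphism⁻ : ∀ {v} → Proper F L′ (σ ⟨$⟩ʳ v) → Proper F L v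
    proper-automorphism⁻ {v} proper u v<u =
      subst₂ Fin._<_ (L′σ≡L v) (L′σ≡L u) (proper (σ ⟨$⟩ʳ u) (properDesc-automorphism σ σ-aut v<u))

  power-prop-iso : ∀ α {L L′} → IsoLab F L L′ → (1ℚ + α) ^ℚ prop F L ≡ (1ℚ + α) ^ℚ prop F L′
  power-prop-iso α {L} {L′} (σ , σ-aut , L′σ≡L) = begin
    (1ℚ + α) ^ℚ prop F L
      ≡⟨ power-filter α (proper? F L) (allFin n) ⟩
    prodℚ (weight α L) (allFin n)
      ≡⟨ Product.big-cong (allFin n) (λ {v} _ → cong (λ z → 1ℚ + α * z)
           (indicator-cong (proper? F L v) (proper? F L′ (σ ⟨$⟩ʳ v))
             (proper-automorphism {L} {L′} σ σ-aut L′σ≡L) (proper-automorphism⁻ {L} {L′} σ σ-aut L′σ≡L))) ⟩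
    prodℚ (weight α L′ ∘ (σ ⟨$⟩ʳ_)) (allFin n)
      ≡⟨ Product.big-reindex (setoid (Fin n)) (cong (weight α L′)) (cong (σ ⟨$⟩ʳ_)) (⟨$⟩ʳ-injective σ) (λ _ → inverseʳ σ)
           (UniqueProp.allFin⁺ n , ∈-allFin) ⟨
    prodℚ (weight α L′) (allFin n)
      ≡⟨ power-filter α (proper? F L′) (allFin n) ⟨
    (1ℚ + α) ^ℚ prop F L′
      ∎
    where open ≡-Reasoning

module Classes {n : ℕ} (F : Forest n) (𝓛 : List (Labeling n)) (𝓛-representatives : IsRepresentatives F 𝓛) where
  open Isomorphisms F

  private
    m : ℕ
    m = length 𝓛
    Ls : List (Labeling n)
    Ls = allPerms n

  representative : Fin m → Labeling n
  representative = lookup 𝓛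

  class : Labeling n → Fin m
  class L = proj₁ (proj₁ 𝓛-representatives L)

  class-iso : ∀ L → IsoLab F L (representative (class L))
  class-iso L = proj₂ (proj₁ 𝓛-representatives L)

  class-unique : ∀ {L j} → IsoLab F L (representative j) → class L ≡ j
  class-unique {L} {j} L≅Rj = proj₂ 𝓛-representatives _ _
    (IsoLab-trans {representative (class L)} {L} {representative j}
      (IsoLab-sym {L} {representative (class L)} (class-iso L)) L≅Rj)

  class-cong : ∀ {L L′} → L ≈ L′ → class L ≡ class L′
  class-cong {L} {L′} L≈L′ =
    class-unique (IsoLab-trans {L} {L′} {representative (class L′)} (IsoLab-reflexive {L} {L′} L≈L′) (class-iso L′))

  class-relabel : ∀ {L j} k → class L ≡ j → class (L ∘ₚ (flip (representative j) ∘ₚ representative k)) ≡ k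
  class-relabel {L} {j} k refl = class-unique {L ∘ₚ π} {k}
    (IsoLab-trans {L ∘ₚ π} {Rj ∘ₚ π} {Rk} (IsoLab-∘ₚ {L} {Rj} π (class-iso L)) (IsoLab-reflexive {Rj ∘ₚ π} {Rk} Rjπ≈Rk))
    where
    Rj Rk : Labeling n
    π : Permutation′ n
    Rj = representative j
    Rk = representative k
    π = flip Rj ∘ₚ Rk
    Rjπ≈Rk : Rj ∘ₚ π ≈ Rk
    Rjπ≈Rk v = cong (Rk ⟨$⟩ʳ_) (inverseˡ Rj)

  -- Each class is a free orbit of Aut F, so classSize j = |Aut F|; only the independence of j is needed.
  classSize : Fin m → ℚ
  classSize j = sumℚ (λ L → indicator (j ≟ᶠ class L)) (allPerms n)

  classSize-const : ∀ j k → classSize j ≡ classSize k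
  classSize-const j k = begin
    classSize j
      ≡⟨ sum-allPerms-∘ₚʳ (λ {L} {L′} L≈L′ → cong (λ c → indicator (j ≟ᶠ c)) (class-cong {L} {L′} L≈L′)) π ⟩
    sumℚ (λ L → indicator (j ≟ᶠ class (L ∘ₚ π))) Ls
      ≡⟨ Sum.big-cong Ls (λ {L} _ → indicator-cong (j ≟ᶠ class (L ∘ₚ π)) (k ≟ᶠ class L)
           (λ j≡ → trans (sym (class-relabel k (sym j≡))) (sym (class-cong (ππ′≈id L))))
           (λ k≡ → sym (class-relabel j (sym k≡)))) ⟩
    classSize k
      ∎
    where
    open ≡-Reasoning
    Rj Rk : Labeling n
    π : Permutation′ n
    Rj = representative j
    Rk = representative k
    π = flip Rk ∘ₚ Rj
    ππ′≈id : ∀ L → L ≈ (L ∘ₚ π) ∘ₚ (flip Rj ∘ₚ Rk)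
    ππ′≈id L v = sym (trans (cong (Rk ⟨$⟩ʳ_) (inverseˡ Rj)) (inverseʳ Rk))

  classSize-nonZero : ∀ j → ∃ λ s → classSize j ≡ ℕtoℚ (suc s)
  classSize-nonZero j = ℕ.pred count , trans (sum-indicator (λ L → j ≟ᶠ class L) Ls)
    (cong ℕtoℚ (sym (ℕP.suc-pred count {{ℕ.>-nonZero (filter-some (λ L → j ≟ᶠ class L) class-j-inhabited)}})))
    where
    count : ℕ
    count = length (filter (λ L → j ≟ᶠ class L) Ls)
    Rj : Labeling n
    Rj = representative j
    class-j-inhabited : Any (λ L → j ≡ class L) Ls
    class-j-inhabited = Any.map
      (λ {L} Rj≈L → trans (sym (class-unique {Rj} (IsoLab-reflexive {Rj} {Rj} λ _ → refl))) (class-cong {Rj} {L} Rj≈L))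
      (proj₂ (allPerms-isEnumeration n) Rj)

  sum-iso-invariant : ∀ {H : Labeling n → ℚ} → (∀ {L L′} → IsoLab F L L′ → H L ≡ H L′) →
    ∀ j → sumℚ H (allPerms n) ≡ classSize j * sumℚ H 𝓛
  sum-iso-invariant {H} H-iso j = begin
    sumℚ H Ls
      ≡⟨ Sum.big-cong Ls (λ {L} _ → H-iso (class-iso L)) ⟩
    sumℚ (H ∘ representative ∘ class) Ls
      ≡⟨ Sum.big-cong Ls (λ {L} _ → sum-select _≟ᶠ_ (H ∘ representative) (UniqueProp.allFin⁺ m) (∈-allFin (class L))) ⟨
    sumℚ (λ L → sumℚ (λ i → indicator (i ≟ᶠ class L) * H (representative i)) (allFin m)) Ls
      ≡⟨ Sum.big-comm (λ L i → indicator (i ≟ᶠ class L) * H (representative i)) Ls (allFin m) ⟩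
    sumℚ (λ i → sumℚ (λ L → indicator (i ≟ᶠ class L) * H (representative i)) Ls) (allFin m)
      ≡⟨ Sum.big-cong (allFin m) (λ {i} _ → sum-*ʳ (H (representative i)) (λ L → indicator (i ≟ᶠ class L)) Ls) ⟩
    sumℚ (λ i → classSize i * H (representative i)) (allFin m)
      ≡⟨ Sum.big-cong (allFin m) (λ {i} _ → cong (_* H (representative i)) (classSize-const i j)) ⟩
    sumℚ (λ i → classSize j * H (representative i)) (allFin m)
      ≡⟨ sum-*ˡ (classSize j) (H ∘ representative) (allFin m) ⟩
    classSize j * sumℚ (H ∘ representative) (allFin m)
      ≡⟨ cong (_*_ (classSize j)) (Sum.big-map H representative (allFin m)) ⟨
    classSize j * sumℚ H (map representative (allFin m))
      ≡⟨ cong (λ xs → classSize j * sumℚ H xs) (trans (map-tabulate id representative) (tabulate-lookup 𝓛)) ⟩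
    classSize j * sumℚ H 𝓛
      ∎
    where open ≡-Reasoning

lemma2p3 : (n : ℕ) (F : Forest n) (𝓛 : List (Labeling n)) →
    IsRepresentatives F 𝓛 → (α : ℚ) →
    sumℚ (λ L → (1ℚ + α) ^ℚ prop F L) 𝓛
      ≡ ℕtoℚ (length 𝓛) * prodℚ (λ v → 1ℚ + α * ((+ 1) / hook F v)) (allFin n)
lemma2p3 n F []         _                 α = sym (ℚP.*-zeroˡ (prodℚ (λ v → 1ℚ + α * ((+ 1) / hook F v)) (allFin n)))
lemma2p3 n F 𝓛@(_ ∷ _) 𝓛-representatives α = ℕtoℚ-cancelˡ s (begin
  ℕtoℚ (suc s) * X                      ≡⟨ cong (_* X) c≡s+1 ⟨
  c * X                                 ≡⟨ sum-iso-invariant (λ {L} {L′} → power-prop-iso α {L} {L′}) Fin.zero ⟨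
  sumℚ (λ L → (1ℚ + α) ^ℚ prop F L) Ls  ≡⟨ sum-power-prop α ⟩
  sumℚ (λ _ → 1ℚ) Ls * P                ≡⟨ cong (_* P) (sum-iso-invariant {λ _ → 1ℚ} (λ _ → refl) Fin.zero) ⟩
  (c * sumℚ (λ _ → 1ℚ) 𝓛) * P           ≡⟨ cong (λ t → (c * t) * P) (trans (sum-const 1ℚ 𝓛) (ℚP.*-identityʳ _)) ⟩
  (c * ℕtoℚ (length 𝓛)) * P             ≡⟨ ℚP.*-assoc c _ P ⟩
  c * (ℕtoℚ (length 𝓛) * P)             ≡⟨ cong (_* (ℕtoℚ (length 𝓛) * P)) c≡s+1 ⟩
  ℕtoℚ (suc s) * (ℕtoℚ (length 𝓛) * P) ∎)
  where
  open ≡-Reasoning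
  open Classes F 𝓛 𝓛-representatives
  open Isomorphisms F using (power-prop-iso)
  open LabelingSums F using (sum-power-prop)
  Ls : List (Labeling n)
  Ls = allPerms n
  c X P : ℚ
  c = classSize Fin.zero
  s : ℕ
  s = proj₁ (classSize-nonZero Fin.zero)
  c≡s+1 : c ≡ ℕtoℚ (suc s)
  c≡s+1 = proj₂ (classSize-nonZero Fin.zero)
  X = sumℚ (λ L → (1ℚ + α) ^ℚ prop F L) 𝓛
  P = prodℚ (λ v → 1ℚ + α * ((+ 1) / hook F v)) (allFin n)
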